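{- The proof system $\mathbb{LS}$ is sound with respect to the class of all frames: every formula derivable in $\mathbb{LS}$ is true at every world of every model.
   Context: $\mathcal{L}_\vartriangleleft$: $A::=p\mid\neg A\mid A\land A\mid A\vartriangleleft A$. A frame is $\langle W,S\rangle$ with $W$ nonempty and $S\subseteq W^3$ arbitrary (written $S_wuv$); a model adds a valuation $V$. $\mathcal{M},w\vDash A\vartriangleleft B$ iff for all $u,v$ with $S_wuv$, if ($\mathcal{M},u\vDash A\iff\mathcal{M},v\vDash A$) then ($\mathcal{M},u\vDash B\iff\mathcal{M},v\vDash B$); other clauses as usual. Abbreviations: $OB:=\top\vartriangleleft B$; $A\Lleftarrow\Rrightarrow B:=(A\vartriangleleft B)\land(B\vartriangleleft A)$. $\mathbb{LS}$ has axiom schemas: A0 all instances of propositional tautologies; A1 $OB\to(A\vartriangleleft B)$; A2 $(A\vartriangleleft B)\to(OA\to OB)$; A3 $O(A\leftrightarrow B)\leftrightarrow(A\Lleftarrow\Rrightarrow B)$; A4 $(A\vartriangleleft B)\land(B\vartriangleleft C)\to(A\vartriangleleft C)$; A5 $(A\vartriangleleft B_1)\land\cdots\land(A\vartriangleleft B_n)\to(A\vartriangleleft\sharp(B_1,\dots,B_n))$ for every $n$-ary Boolean connective $\sharp$; and rules R1 (from $A\to B$ and $A$ infer $B$) and R2 (from $A$ infer $OA$). -}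

module Defs where

open import Data.Nat using (ℕ)
open import Data.Fin using (Fin)
open import Data.Vec using (Vec; lookup; _∷_; [])
open import Data.Bool using (Bool; true; false; not; _∧_)
open import Data.Product using (_×_; Σ)
open import Relation.Nullary using (¬_)
open import Relation.Binary.PropositionalEquality using (_≡_)
open import Function.Bundles using (_⇔_)
open import Level using (Level; _⊔_; suc)

infix 8 ¬'_
infixr 6 _∧'_
infixr 4 _⇒_
infix 5 _◁_
data Fm : Set where
  var  : ℕ → Fm
  ¬'_  : Fm → Fm
  _∧'_ : Fm → Fm → Fm
  _◁_  : Fm → Fm → Fm

_∨'_ : Fm → Fm → Fm
A ∨' B = ¬' (¬' A ∧' ¬' B)

_⇒_ : Fm → Fm → Fm
A ⇒ B = ¬' (A ∧' ¬' B)

_⇔'_ : Fm → Fm → Fm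
A ⇔' B = (A ⇒ B) ∧' (B ⇒ A)

⊤' : Fm
⊤' = ¬' (var 0 ∧' ¬' (var 0))

O : Fm → Fm
O B = ⊤' ◁ B

_⋈_ : Fm → Fm → Fm
A ⋈ B = (A ◁ B) ∧' (B ◁ A)

-- n-ary Boolean connectives: terms built from argument places, ⊤, ¬ and ∧
data BC (n : ℕ) : Set where
  arg  : Fin n → BC n
  top  : BC n
  neg  : BC n → BC n
  conj : BC n → BC n → BC n

apply : ∀ {n} → BC n → Vec Fm n → Fm
apply (arg i)    Bs = lookup Bs i
apply top        Bs = ⊤'
apply (neg c)    Bs = ¬' apply c Bs
apply (conj c d) Bs = apply c Bs ∧' apply d Bs

-- Propositional tautologies: true under every Boolean assignment to the
-- propositional atoms, where variables and ◁-formulas are the atoms.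
beval : (Fm → Bool) → Fm → Bool
beval f (var p)  = f (var p)
beval f (¬' A)   = not (beval f A)
beval f (A ∧' B) = beval f A ∧ beval f B
beval f (A ◁ B)  = f (A ◁ B)

Tautology : Fm → Set
Tautology A = (f : Fm → Bool) → beval f A ≡ true

conjTri : ∀ {n} → Fm → Vec Fm n → Fm
conjTri A []       = ⊤'
conjTri A (B ∷ []) = A ◁ B
conjTri A (B ∷ Bs@(_ ∷ _)) = (A ◁ B) ∧' conjTri A Bs

data ⊢_ : Fm → Set where
  A0 : ∀ {A} → Tautology A → ⊢ A
  A1 : ∀ A B → ⊢ (O B ⇒ (A ◁ B))
  A2 : ∀ A B → ⊢ ((A ◁ B) ⇒ (O A ⇒ O B))
  A3 : ∀ A B → ⊢ (O (A ⇔' B) ⇔' (A ⋈ B))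
  A4 : ∀ A B C → ⊢ (((A ◁ B) ∧' (B ◁ C)) ⇒ (A ◁ C))
  A5 : ∀ {n} (♯ : BC n) A (Bs : Vec Fm n) → ⊢ (conjTri A Bs ⇒ (A ◁ apply ♯ Bs))
  R1 : ∀ {A B} → ⊢ (A ⇒ B) → ⊢ A → ⊢ B
  R2 : ∀ {A} → ⊢ A → ⊢ O A

record Frame (a b : Level) : Set (Level.suc (a ⊔ b)) where
  field
    W : Set a
    inhabited : W
    S : W → W → W → Set b

record Model (a b c : Level) : Set (Level.suc (a ⊔ b ⊔ c)) where
  field
    frame : Frame a b
  open Frame frame public
  field
    V : ℕ → W → Set c

module _ {a b c} (M : Model a b c) where
  open Model M
  infix 2 _⊨_
  _⊨_ : W → Fm → Set (a ⊔ b ⊔ c)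
  w ⊨ var p  = Level.Lift (a ⊔ b) (V p w)
  w ⊨ ¬' A   = ¬ (w ⊨ A)
  w ⊨ A ∧' B = (w ⊨ A) × (w ⊨ B)
  w ⊨ A ◁ B  = (u v : W) → S w u v → ((u ⊨ A) ⇔ (v ⊨ A)) → ((u ⊨ B) ⇔ (v ⊨ B))

-- Under excluded middle satisfaction is decidable, so every world x assigns a truth
-- value to each formula, and this assignment is a Boolean valuation in which variables
-- and ◁-formulas are the atoms; hence tautologies hold everywhere. The clause for A ◁ B
-- says that, on S_w-pairs, agreement on A propagates to agreement on B. Agreement on ⊤
-- is automatic and agreement is preserved by ¬ and ∧, which gives A1, A2, A4, A5 and R2.
-- A3 is the Boolean fact that (a ↔ b) = (a' ↔ b') iff (a = a' ↔ b = b').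
module Submission where

open import Defs
open import Level using (Level; _⊔_)
open import Axiom.ExcludedMiddle using (ExcludedMiddle)
open import Data.Bool using (Bool; true; false; not; _∧_; _xor_; _≟_)
open import Data.Bool.Properties using (not-injective; not-involutive; ¬-not; xor-comm)
open import Data.Fin using (zero; suc)
open import Data.Vec using (Vec; lookup; _∷_; [])
open import Data.Product using (_,_)
open import Data.Product.Function.NonDependent.Propositional using (_×-⇔_)
open import Function.Base using (id; _∘_; const)
open import Function.Bundles using (_⇔_; mk⇔; Equivalence)
open import Function.Construct.Composition using (_⇔-∘_)
open import Function.Construct.Identity using (⇔-id)
open import Function.Construct.Symmetry using (⇔-sym)
open import Function.Related.Propositional using (module EquationalReasoning)
open import Function.Related.TypeIsomorphisms using (¬-cong-⇔)
open import Relation.Binary.Definitions using (Decidable)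
open import Relation.Binary.PropositionalEquality using (_≡_; refl; sym; trans; cong; cong₂; module ≡-Reasoning)
open import Relation.Nullary using (yes; no; does; ¬?; _×-dec_)
open import Relation.Nullary.Decidable using (dec-true; does-⇔; decidable-stable)

open Equivalence using (to; from)

⇔-cong : ∀ {a a′ b b′} {A : Set a} {A′ : Set a′} {B : Set b} {B′ : Set b′} →
         A ⇔ A′ → B ⇔ B′ → (A ⇔ B) ⇔ (A′ ⇔ B′)
⇔-cong A⇔A′ B⇔B′ = mk⇔ (λ A⇔B → B⇔B′ ⇔-∘ (A⇔B ⇔-∘ ⇔-sym A⇔A′))
                       (λ A′⇔B′ → ⇔-sym B⇔B′ ⇔-∘ (A′⇔B′ ⇔-∘ A⇔A′))

xor-cancelˡ : ∀ x {y z} → x xor y ≡ x xor z → y ≡ z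
xor-cancelˡ true  = not-injective
xor-cancelˡ false = id

not-xor-not : ∀ x y → not x xor not y ≡ x xor y
not-xor-not true  y = refl
not-xor-not false y = not-involutive y

xor-≡⇔ : ∀ x y x′ y′ → (x xor y ≡ x′ xor y′) ⇔ (x ≡ x′ ⇔ y ≡ y′)
xor-≡⇔ x y x′ y′ = mk⇔ agreement-transfers xor-agrees
  where
  agreement-transfers : x xor y ≡ x′ xor y′ → x ≡ x′ ⇔ y ≡ y′
  agreement-transfers e = mk⇔
    (λ { refl → xor-cancelˡ x e })
    (λ { refl → xor-cancelˡ y (trans (xor-comm y x) (trans e (xor-comm x′ y))) })

  xor-agrees : x ≡ x′ ⇔ y ≡ y′ → x xor y ≡ x′ xor y′
  xor-agrees x≡x′⇔y≡y′ with y ≟ y′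
  ... | yes refl = cong (_xor y) (from x≡x′⇔y≡y′ refl)
  ... | no y≢y′ = begin
    x xor y             ≡⟨ cong₂ _xor_ (¬-not (y≢y′ ∘ to x≡x′⇔y≡y′)) (¬-not y≢y′) ⟩
    not x′ xor not y′   ≡⟨ not-xor-not x′ y′ ⟩
    x′ xor y′           ∎
    where open ≡-Reasoning

biconditional≡not-xor : ∀ x y → not (x ∧ not y) ∧ not (y ∧ not x) ≡ not (x xor y)
biconditional≡not-xor true  true  = refl
biconditional≡not-xor true  false = refl
biconditional≡not-xor false true  = refl
biconditional≡not-xor false false = refl

module Soundness {a b c} (M : Model a b c) (satisfaction? : Decidable (_⊨_ M)) where
  open Model M

  -- Satisfaction is computed by recursion on the formula, so formulas cannot be
  -- inferred from satisfaction types; lemmas on a compound formula take its parts explicitly.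
  infix 2 _⊩_
  _⊩_ : W → Fm → Set (a ⊔ b ⊔ c)
  _⊩_ = _⊨_ M

  infix 4 _⊩?_
  _⊩?_ : Decidable _⊩_
  _⊩?_ = satisfaction?

  _≈⟨_⟩_ : W → Fm → W → Set (a ⊔ b ⊔ c)
  u ≈⟨ A ⟩ v = (u ⊩ A) ⇔ (v ⊩ A)

  ⇒-intro : ∀ {x} A B → (x ⊩ A → x ⊩ B) → x ⊩ A ⇒ B
  ⇒-intro _ _ f (x⊩A , x⊮B) = x⊮B (f x⊩A)

  ⇒-elim : ∀ {x A B} → x ⊩ A ⇒ B → x ⊩ A → x ⊩ B
  ⇒-elim {x} {B = B} x⊩A⇒B x⊩A = decidable-stable (x ⊩? B) (λ x⊮B → x⊩A⇒B (x⊩A , x⊮B))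

  ⇔'-intro : ∀ {x} A B → (x ⊩ A → x ⊩ B) → (x ⊩ B → x ⊩ A) → x ⊩ A ⇔' B
  ⇔'-intro A B f g = ⇒-intro A B f , ⇒-intro B A g

  ⊤'-holds : ∀ {x} → x ⊩ ⊤'
  ⊤'-holds (x⊩p , x⊮p) = x⊮p x⊩p

  ≈-⊤' : ∀ {u v} → u ≈⟨ ⊤' ⟩ v
  ≈-⊤' = mk⇔ (const ⊤'-holds) (const ⊤'-holds)

  O-elim : ∀ {w u v} B → w ⊩ O B → S w u v → u ≈⟨ B ⟩ v
  O-elim _ w⊩OB s = w⊩OB _ _ s ≈-⊤'

  O-intro : ∀ {w} B → (∀ u v → S w u v → u ≈⟨ B ⟩ v) → w ⊩ O B
  O-intro _ f u v s _ = f u v s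

  ≈-apply : ∀ {n u v} {Bs : Vec Fm n} (♯ : BC n) →
            (∀ i → u ≈⟨ lookup Bs i ⟩ v) → u ≈⟨ apply ♯ Bs ⟩ v
  ≈-apply (arg i)    ≈Bs = ≈Bs i
  ≈-apply top        ≈Bs = ≈-⊤'
  ≈-apply (neg ♯)    ≈Bs = ¬-cong-⇔ (≈-apply ♯ ≈Bs)
  ≈-apply (conj ♯ ♭) ≈Bs = ≈-apply ♯ ≈Bs ×-⇔ ≈-apply ♭ ≈Bs

  conjTri-elim : ∀ {n w A} {Bs : Vec Fm n} → w ⊩ conjTri A Bs → ∀ i → w ⊩ A ◁ lookup Bs i
  conjTri-elim {Bs = _ ∷ []}    w⊩A◁B          zero    = w⊩A◁B
  conjTri-elim {Bs = _ ∷ _ ∷ _} (w⊩A◁B , _)    zero    = w⊩A◁B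
  conjTri-elim {Bs = _ ∷ _ ∷ _} (_ , w⊩A◁Bs) (suc i) = conjTri-elim w⊩A◁Bs i

  truth : W → Fm → Bool
  truth x A = does (x ⊩? A)

  truth-sound : ∀ {x A} → truth x A ≡ true → x ⊩ A
  truth-sound {x} {A} e with x ⊩? A
  truth-sound {x} {A} e  | yes x⊩A = x⊩A
  truth-sound {x} {A} () | no _

  truth-¬' : ∀ x A → truth x (¬' A) ≡ not (truth x A)
  truth-¬' x A = does-⇔ (⇔-id _) (x ⊩? ¬' A) (¬? (x ⊩? A))

  truth-∧' : ∀ x A B → truth x (A ∧' B) ≡ truth x A ∧ truth x B
  truth-∧' x A B = does-⇔ (⇔-id _) (x ⊩? A ∧' B) (x ⊩? A ×-dec x ⊩? B)

  truth-⇒ : ∀ x A B → truth x (A ⇒ B) ≡ not (truth x A ∧ not (truth x B))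
  truth-⇒ x A B = trans (truth-¬' x _) (cong not (trans (truth-∧' x A _) (cong (truth x A ∧_) (truth-¬' x B))))

  truth-⇔' : ∀ x A B → truth x (A ⇔' B) ≡ not (truth x A xor truth x B)
  truth-⇔' x A B = begin
    truth x (A ⇔' B)                                           ≡⟨ truth-∧' x _ _ ⟩
    truth x (A ⇒ B) ∧ truth x (B ⇒ A)                          ≡⟨ cong₂ _∧_ (truth-⇒ x A B) (truth-⇒ x B A) ⟩
    not (truth x A ∧ not (truth x B)) ∧ not (truth x B ∧ not (truth x A)) ≡⟨ biconditional≡not-xor (truth x A) (truth x B) ⟩
    not (truth x A xor truth x B)                              ∎
    where open ≡-Reasoning

  beval-truth : ∀ x A → beval (truth x) A ≡ truth x A
  beval-truth x (var p)  = refl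
  beval-truth x (¬' A)   = trans (cong not (beval-truth x A)) (sym (truth-¬' x A))
  beval-truth x (A ∧' B) = trans (cong₂ _∧_ (beval-truth x A) (beval-truth x B)) (sym (truth-∧' x A B))
  beval-truth x (A ◁ B)  = refl

  tautology-holds : ∀ {A} → Tautology A → ∀ x → x ⊩ A
  tautology-holds {A} taut x = truth-sound (trans (sym (beval-truth x A)) (taut (truth x)))

  ≈⇔truth-≡ : ∀ {u v A} → u ≈⟨ A ⟩ v ⇔ (truth u A ≡ truth v A)
  ≈⇔truth-≡ {u} {v} {A} = mk⇔
    (λ u≈v → does-⇔ u≈v (u ⊩? A) (v ⊩? A))
    (λ e → mk⇔ (λ u⊩A → truth-sound (trans (sym e) (dec-true (u ⊩? A) u⊩A)))
               (λ v⊩A → truth-sound (trans e (dec-true (v ⊩? A) v⊩A))))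

  ≈-⇔' : ∀ {u v} A B → u ≈⟨ A ⇔' B ⟩ v ⇔ (u ≈⟨ A ⟩ v ⇔ u ≈⟨ B ⟩ v)
  ≈-⇔' {u} {v} A B = begin
    u ≈⟨ A ⇔' B ⟩ v                                     ∼⟨ ≈⇔truth-≡ ⟩
    truth u (A ⇔' B) ≡ truth v (A ⇔' B)                 ≡⟨ cong₂ _≡_ (truth-⇔' u A B) (truth-⇔' v A B) ⟩
    not (tA u xor tB u) ≡ not (tA v xor tB v)           ∼⟨ mk⇔ not-injective (cong not) ⟩
    tA u xor tB u ≡ tA v xor tB v                       ∼⟨ xor-≡⇔ (tA u) (tB u) (tA v) (tB v) ⟩
    (tA u ≡ tA v ⇔ tB u ≡ tB v)                         ∼⟨ ⇔-cong (⇔-sym ≈⇔truth-≡) (⇔-sym ≈⇔truth-≡) ⟩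
    (u ≈⟨ A ⟩ v ⇔ u ≈⟨ B ⟩ v)                           ∎
    where
    open EquationalReasoning
    tA tB : W → Bool
    tA x = truth x A
    tB x = truth x B

  O⇔'⇔⋈ : ∀ {w} A B → (w ⊩ O (A ⇔' B)) ⇔ (w ⊩ A ⋈ B)
  O⇔'⇔⋈ {w} A B = mk⇔ O⇔'→⋈ ⋈→O⇔'
    where
    O⇔'→⋈ : w ⊩ O (A ⇔' B) → w ⊩ A ⋈ B
    O⇔'→⋈ w⊩O⇔ = (λ u v s → to (agreement s)) , (λ u v s → from (agreement s))
      where
      agreement : ∀ {u v} → S w u v → u ≈⟨ A ⟩ v ⇔ u ≈⟨ B ⟩ v
      agreement s = to (≈-⇔' A B) (O-elim (A ⇔' B) w⊩O⇔ s)

    ⋈→O⇔' : w ⊩ A ⋈ B → w ⊩ O (A ⇔' B)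
    ⋈→O⇔' (w⊩A◁B , w⊩B◁A) = O-intro (A ⇔' B) λ u v s → from (≈-⇔' A B) (mk⇔ (w⊩A◁B u v s) (w⊩B◁A u v s))

  sound : ∀ {A} → ⊢ A → ∀ w → w ⊩ A
  sound (A0 taut)   w = tautology-holds taut w
  sound (A1 A B)    w = ⇒-intro (O B) (A ◁ B) λ w⊩OB u v s _ → O-elim B w⊩OB s
  sound (A2 A B)    w = ⇒-intro (A ◁ B) (O A ⇒ O B) λ w⊩A◁B → ⇒-intro (O A) (O B) λ w⊩OA →
    O-intro B λ u v s → w⊩A◁B u v s (O-elim A w⊩OA s)
  sound (A3 A B)    w = ⇔'-intro (O (A ⇔' B)) (A ⋈ B) (to (O⇔'⇔⋈ A B)) (from (O⇔'⇔⋈ A B))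
  sound (A4 A B C)  w = ⇒-intro ((A ◁ B) ∧' (B ◁ C)) (A ◁ C) λ (w⊩A◁B , w⊩B◁C) u v s →
    w⊩B◁C u v s ∘ w⊩A◁B u v s
  sound (A5 ♯ A Bs) w = ⇒-intro (conjTri A Bs) (A ◁ apply ♯ Bs) λ w⊩conj u v s u≈v →
    ≈-apply ♯ λ i → conjTri-elim w⊩conj i u v s u≈v
  sound (R1 ⊢A⇒B ⊢A) w = ⇒-elim (sound ⊢A⇒B w) (sound ⊢A w)
  sound (R2 {A} ⊢A) w = O-intro A λ u v _ → mk⇔ (const (sound ⊢A v)) (const (sound ⊢A u))

proposition5p3 : ∀ {a b c : Level} → ExcludedMiddle (a Level.⊔ b Level.⊔ c) →
    (A : Fm) → ⊢ A → (M : Model a b c) → (w : Model.W M) → _⊨_ M w A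
proposition5p3 em A ⊢A M = Soundness.sound M (λ _ _ → em) ⊢A
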